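{- Let $n$ be sufficiently large. Assume an unbiased Walker-Breaker game on $K_n$ is in progress, in which Walker has claimed (all edges of) a cycle $C$ with $n-125\le v(C)\le n-3$ and her current position is a vertex $x\in V(C)$. Assume further that Breaker has claimed at most $2n$ edges so far, and that there is at most one vertex $y\in V(K_n)\setminus V(C)$ with $d_B(y,V(C))\ge \frac{n}{10}$. Then Walker has a strategy to create a cycle $C'$ with $V(C)\subsetneq V(C')$ within less than $25$ further rounds.
   Context: In the unbiased Walker-Breaker game on $K_n$, Walker and Breaker alternately claim edges of $K_n$. Walker has a current position $v$; in her move she must choose an edge $vw$ incident with $v$ that has not been claimed by Breaker (it may already be hers), claims it if not already hers, and $w$ becomes her new position. Breaker claims one edge not yet claimed by either player in each move, without restriction. $B$ denotes Breaker's graph, and $d_B(y,A)$ is the number of vertices of $A$ joined to $y$ by an edge of $B$. $v(C)$ is the number of vertices of $C$. -}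

module Defs where

open import Data.Nat using (ℕ; zero; suc; _≤_; _+_; _*_)
open import Data.Fin using (Fin)
open import Data.Fin.Properties using () renaming (_≟_ to _≟ᶠ_)
open import Data.Product using (_×_; _,_; Σ; ∃; ∃-syntax)
open import Data.Product.Properties using (≡-dec)
open import Data.Sum using (_⊎_)
open import Data.Unit using (⊤)
open import Data.Empty using (⊥)
open import Data.List using (List; []; _∷_; length; filter; _∷ʳ_)
open import Data.List.Membership.Propositional using (_∈_; _∉_)
open import Data.List.Membership.DecPropositional using () renaming (_∈?_ to member?)
open import Data.List.Relation.Unary.Unique.Propositional using (Unique)
open import Relation.Binary.PropositionalEquality using (_≡_; _≢_)
open import Relation.Nullary using (¬_; Dec)
open import Relation.Nullary.Decidable using (_⊎-dec_)

-- An edge claimed by a player is recorded as an ordered pair of vertices of K_n;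
-- a graph is the list of its claimed edges, read as unordered pairs.
Edges : ℕ → Set
Edges n = List (Fin n × Fin n)

Adj : ∀ {n} → Edges n → Fin n → Fin n → Set
Adj G u v = (u , v) ∈ G ⊎ (v , u) ∈ G

Adj? : ∀ {n} (G : Edges n) (u v : Fin n) → Dec (Adj G u v)
Adj? G u v = member? (≡-dec _≟ᶠ_ _≟ᶠ_) (u , v) G ⊎-dec member? (≡-dec _≟ᶠ_ _≟ᶠ_) (v , u) G

-- d_G(y, A): number of vertices of A (a duplicate-free list) joined to y by an edge of G
deg : ∀ {n} → Edges n → Fin n → List (Fin n) → ℕ
deg G y A = length (filter (Adj? G y) A)

Path : ∀ {n} → Edges n → List (Fin n) → Set
Path G [] = ⊤
Path G (x ∷ []) = ⊤
Path G (x ∷ y ∷ r) = Adj G x y × Path G (y ∷ r)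

-- the list v₀ … v_{k-1} of distinct vertices (k ≥ 3) is a cycle all of whose
-- edges v₀v₁, …, v_{k-2}v_{k-1}, v_{k-1}v₀ belong to G;  V(C) = its entries, v(C) = length
IsCycle : ∀ {n} → Edges n → List (Fin n) → Set
IsCycle G [] = ⊥
IsCycle G (v ∷ r) = (3 ≤ length (v ∷ r)) × Unique (v ∷ r) × Path G ((v ∷ r) ∷ʳ v)

-- A position of the game (with Walker to move)
record State (n : ℕ) : Set where
  constructor st
  field
    walker  : Edges n
    breaker : Edges n
    pos     : Fin n
open State public

WalkerLegal : ∀ {n} → State n → Fin n → Set
WalkerLegal s w = (pos s ≢ w) × ¬ Adj (breaker s) (pos s) w

walk : ∀ {n} → State n → Fin n → State n
walk s w = st ((pos s , w) ∷ walker s) (breaker s) w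

BreakerLegal : ∀ {n} → State n → Fin n → Fin n → Set
BreakerLegal s u v = (u ≢ v) × ¬ Adj (walker s) u v × ¬ Adj (breaker s) u v

claim : ∀ {n} → State n → Fin n → Fin n → State n
claim s u v = st (walker s) ((u , v) ∷ breaker s) (pos s)

-- positions arising in an actual play of the game after some number of full rounds
-- (Walker chooses her start vertex; each round is a Walker move followed by a Breaker move)
data Reachable {n : ℕ} : State n → Set where
  start : (v : Fin n) → Reachable (st [] [] v)
  round : ∀ {s} w u v → Reachable s → WalkerLegal s w →
          BreakerLegal (walk s w) u v → Reachable (claim (walk s w) u v)

Goal : ∀ {n} → List (Fin n) → State n → Set
Goal C s = ∃[ C' ] IsCycle (walker s) C' × (∀ z → z ∈ C → z ∈ C') × (∃[ z ] z ∈ C' × z ∉ C)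

Forces : ∀ {n} → ℕ → List (Fin n) → State n → Set
Forces zero C s = Goal C s
Forces (suc k) C s = Goal C s ⊎
  (∃[ w ] WalkerLegal s w ×
     (Goal C (walk s w) ⊎
      (∀ u v → BreakerLegal (walk s w) u v → Forces k C (claim (walk s w) u v))))

AtMostOneHeavy : ∀ {n} → Edges n → List (Fin n) → Set
AtMostOneHeavy {n} B C = ∀ y y' → y ∉ C → y' ∉ C →
  n ≤ 10 * deg B y C → n ≤ 10 * deg B y' C → y ≡ y'

module Submission where

-- Fix two outside vertices y₁, y₂ with d_B(yᵢ, V(C)) < n/10.  Phase one: while
-- her position z has d_B(z, V(C)) ≥ n/4, Walker walks on along C over her own edges, which
-- Breaker cannot block.  By the handshake bound fewer than 17 vertices are that heavy, so
-- after at most 17 rounds she stands on a light vertex, and d_B(yᵢ, V(C)) has grown by at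
-- most 17.  Phase two: counting over all rotations of C finds a cycle vertex a, legal for
-- Walker, whose cycle neighbours b₁, b₂ and a itself are joined by Breaker to neither yᵢ.
-- Walker moves to a, then to a yᵢ still untouched after Breaker's reply, then to b₁ or b₂
-- (Breaker can block only one), closing the cycle C - abⱼ + ayᵢ + yᵢbⱼ.

open import Defs
open import Data.Nat using (ℕ; zero; suc; _+_; _*_; _∸_; _≤_; _<_; z≤n; s≤s; _≤?_)
open import Data.Nat.Properties
open import Data.Nat.Tactic.RingSolver using (solve-∀)
open import Algebra.Properties.CommutativeSemigroup +-commutativeSemigroup using (interchange)
open import Data.Fin using (Fin)
open import Data.Fin.Properties using () renaming (_≟_ to _≟ᶠ_)
open import Data.List using (List; []; _∷_; _++_; _∷ʳ_; length; filter; map; iterate; allFin)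
open import Data.Nat.ListAction using (sum)
open import Data.List.Properties using (++-assoc; ++-identityʳ; length-++; map-∘; filter-none; filter-accept; filter-reject; length-tabulate; length-iterate)
open import Data.List.Membership.Propositional using (_∈_; _∉_; find)
open import Data.List.Membership.Propositional.Properties using (∈-++⁺ʳ; ∈-filter⁻; ∈-map⁻)
import Data.List.Membership.DecPropositional as DecMembership
open import Data.List.Relation.Unary.Any using (here; there; any?)
open import Data.List.Relation.Unary.All as All using (All; []; _∷_)
open import Data.List.Relation.Unary.All.Properties using (¬Any⇒All¬; ++⁻ˡ; ++⁺)
open import Data.List.Relation.Unary.AllPairs using ([]; _∷_)
open import Data.List.Relation.Unary.Unique.Propositional using (Unique)
import Data.List.Relation.Unary.Unique.Propositional.Properties as UP
open import Data.List.Relation.Binary.Permutation.Propositional using (_↭_; ↭-refl; ↭-sym; ↭-trans)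
open import Data.List.Relation.Binary.Permutation.Propositional.Properties using (↭-length; filter-↭; ∷↭∷ʳ; ∈-resp-↭)
open import Data.Product using (_×_; _,_; proj₁; proj₂; ∃-syntax)
open import Data.Sum using (_⊎_; inj₁; inj₂)
open import Data.Unit using (tt)
open import Data.Empty using (⊥; ⊥-elim)
open import Relation.Binary.PropositionalEquality using (_≡_; _≢_; refl; sym; trans; cong; cong₂; subst; module ≡-Reasoning)
open import Relation.Nullary using (¬_; yes; no)
open import Relation.Unary using (Decidable)
open import Relation.Unary.Properties using (_∪?_; ∁?)
open import Function using (_∘_)

module _ {A : Set} where

  count : {P : A → Set} → Decidable P → List A → ℕ
  count P? xs = length (filter P? xs)

  count-mono : {P Q : A → Set} (P? : Decidable P) (Q? : Decidable Q) →
               (∀ {x} → P x → Q x) → ∀ xs → count P? xs ≤ count Q? xs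
  count-mono P? Q? P⇒Q [] = z≤n
  count-mono P? Q? P⇒Q (x ∷ xs) with P? x | Q? x
  ... | yes _  | yes _  = s≤s (count-mono P? Q? P⇒Q xs)
  ... | yes px | no ¬qx = ⊥-elim (¬qx (P⇒Q px))
  ... | no _   | yes _  = m≤n⇒m≤1+n (count-mono P? Q? P⇒Q xs)
  ... | no _   | no _   = count-mono P? Q? P⇒Q xs

  count-∪ : {P Q : A → Set} (P? : Decidable P) (Q? : Decidable Q) →
            ∀ xs → count (P? ∪? Q?) xs ≤ count P? xs + count Q? xs
  count-∪ P? Q? [] = z≤n
  count-∪ P? Q? (x ∷ xs) with P? x | Q? x
  ... | yes _ | yes _ = s≤s (≤-trans (count-∪ P? Q? xs) (+-monoʳ-≤ (count P? xs) (n≤1+n _)))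
  ... | yes _ | no _  = s≤s (count-∪ P? Q? xs)
  ... | no _  | yes _ = ≤-trans (s≤s (count-∪ P? Q? xs)) (≤-reflexive (sym (+-suc _ _)))
  ... | no _  | no _  = count-∪ P? Q? xs

  count-↭ : {P : A → Set} (P? : Decidable P) {xs ys : List A} → xs ↭ ys → count P? xs ≡ count P? ys
  count-↭ P? xs↭ys = ↭-length (filter-↭ P? xs↭ys)

  count-≤1 : {P : A → Set} (P? : Decidable P) → (∀ {x y} → P x → P y → x ≡ y) →
             ∀ {xs} → Unique xs → count P? xs ≤ 1
  count-≤1 P? one {[]} [] = z≤n
  count-≤1 P? one {x ∷ xs} (x∉xs ∷ uniq) with P? x
  ... | no _  = count-≤1 P? one uniq
  ... | yes px = s≤s (≤-reflexive (cong length (filter-none P? (All.map (λ x≢y py → x≢y (one px py)) x∉xs))))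

  count<length⇒∃¬ : {P : A → Set} (P? : Decidable P) → ∀ xs → count P? xs < length xs → ∃[ x ] x ∈ xs × ¬ P x
  count<length⇒∃¬ P? (x ∷ xs) lt with P? x
  ... | no ¬px = x , here refl , ¬px
  ... | yes _ with count<length⇒∃¬ P? xs (≤-pred lt)
  ...   | y , y∈xs , ¬py = y , there y∈xs , ¬py

  count+count-∁ : {P : A → Set} (P? : Decidable P) → ∀ xs → count P? xs + count (∁? P?) xs ≡ length xs
  count+count-∁ P? [] = refl
  count+count-∁ P? (x ∷ xs) with P? x
  ... | yes _ = cong suc (count+count-∁ P? xs)
  ... | no _  = trans (+-suc _ _) (cong suc (count+count-∁ P? xs))

module _ {A B : Set} where

  count-map : {P : B → Set} (P? : Decidable P) (f : A → B) → ∀ xs → count P? (map f xs) ≡ count (P? ∘ f) xs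
  count-map P? f [] = refl
  count-map P? f (x ∷ xs) with P? (f x)
  ... | yes _ = cong suc (count-map P? f xs)
  ... | no _  = count-map P? f xs

module _ {A : Set} where

  unique-++ˡ : ∀ xs {ys : List A} → Unique (xs ++ ys) → Unique xs
  unique-++ˡ []       _               = []
  unique-++ˡ (x ∷ xs) (x∉ ∷ uniq) = ++⁻ˡ xs x∉ ∷ unique-++ˡ xs uniq

  length-∷ʳ : ∀ xs (x : A) → length (xs ∷ʳ x) ≡ suc (length xs)
  length-∷ʳ xs x = trans (length-++ xs) (+-comm (length xs) 1)

  unique-++ʳ : ∀ xs {ys : List A} → Unique (xs ++ ys) → Unique ys
  unique-++ʳ []       uniq          = uniq
  unique-++ʳ (x ∷ xs) (_ ∷ uniq) = unique-++ʳ xs uniq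

-- Rotations of a list (a cycle read from different starting vertices).
module _ {A : Set} where

  rot : List A → List A
  rot []       = []
  rot (x ∷ xs) = xs ∷ʳ x

  rot-↭ : ∀ xs → rot xs ↭ xs
  rot-↭ []       = ↭-refl
  rot-↭ (x ∷ xs) = ↭-sym (∷↭∷ʳ x xs)

  rot-unique : ∀ {xs} → Unique xs → Unique (rot xs)
  rot-unique {[]}     []             = []
  rot-unique {x ∷ xs} (x∉xs ∷ uniq) = UP.++⁺ uniq ([] ∷ []) λ { (x∈xs , here refl) → UP.Unique[x∷xs]⇒x∉xs (x∉xs ∷ uniq) x∈xs }

  rotate : ℕ → List A → List A
  rotate zero    xs = xs
  rotate (suc k) xs = rotate k (rot xs)

  rotate-rot : ∀ k xs → rotate k (rot xs) ≡ rot (rotate k xs)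
  rotate-rot zero    xs = refl
  rotate-rot (suc k) xs = rotate-rot k (rot xs)

  rotate-↭ : ∀ k xs → rotate k xs ↭ xs
  rotate-↭ zero    xs = ↭-refl
  rotate-↭ (suc k) xs = ↭-trans (rotate-↭ k (rot xs)) (rot-↭ xs)

  rotations : List A → List (List A)
  rotations xs = iterate rot xs (length xs)

  iterate-rot-preserves : (P : List A → Set) → (∀ {ys} → P ys → P (rot ys)) →
                          ∀ m {xs ys} → P xs → ys ∈ iterate rot xs m → P ys
  iterate-rot-preserves P rot-P (suc m) p (here refl) = p
  iterate-rot-preserves P rot-P (suc m) p (there ys∈) = iterate-rot-preserves P rot-P m (rot-P p) ys∈

  rotations-preserve : (P : List A → Set) → (∀ {ys} → P ys → P (rot ys)) →
                       ∀ {xs ys} → P xs → ys ∈ rotations xs → P ys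
  rotations-preserve P rot-P {xs} = iterate-rot-preserves P rot-P (length xs)

  map-rotate-iterate : ∀ k m xs → map (rotate k) (iterate rot xs m) ≡ iterate rot (rotate k xs) m
  map-rotate-iterate k zero    xs = refl
  map-rotate-iterate k (suc m) xs =
    cong (rotate k xs ∷_) (trans (map-rotate-iterate k m (rot xs)) (cong (λ ys → iterate rot ys m) (rotate-rot k xs)))

  hd : A → List A → A
  hd d []      = d
  hd d (x ∷ _) = x

  heads-iterate-rot : ∀ d xs ys → map (hd d) (iterate rot (xs ++ ys) (length xs)) ≡ xs
  heads-iterate-rot d []       ys = refl
  heads-iterate-rot d (x ∷ xs) ys = cong (x ∷_) (begin
    map (hd d) (iterate rot ((xs ++ ys) ∷ʳ x) (length xs))   ≡⟨ cong (λ zs → map (hd d) (iterate rot zs (length xs))) (++-assoc xs ys (x ∷ [])) ⟩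
    map (hd d) (iterate rot (xs ++ (ys ∷ʳ x)) (length xs))   ≡⟨ heads-iterate-rot d xs (ys ∷ʳ x) ⟩
    xs                                                      ∎)
    where open ≡-Reasoning

  heads-rotations : ∀ d xs → map (hd d) (rotations xs) ≡ xs
  heads-rotations d xs =
    trans (cong (λ zs → map (hd d) (iterate rot zs (length xs))) (sym (++-identityʳ xs))) (heads-iterate-rot d xs [])

  -- Hence, for each k, the k-th entries of the rotations run through xs (up to order),
  -- so a property of the k-th entry holds for as many rotations as entries of xs satisfy it.
  count-rotations : {P : A → Set} (P? : Decidable P) (d : A) (k : ℕ) →
                    ∀ xs → count (P? ∘ hd d ∘ rotate k) (rotations xs) ≡ count P? xs
  count-rotations P? d k xs = begin
    count (P? ∘ hd d ∘ rotate k) (rotations xs)                   ≡⟨ count-map P? (hd d ∘ rotate k) (rotations xs) ⟨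
    count P? (map (hd d ∘ rotate k) (rotations xs))               ≡⟨ cong (count P?) (map-∘ (rotations xs)) ⟩
    count P? (map (hd d) (map (rotate k) (rotations xs)))         ≡⟨ cong (count P? ∘ map (hd d)) (map-rotate-iterate k (length xs) xs) ⟩
    count P? (map (hd d) (iterate rot (rotate k xs) (length xs))) ≡⟨ cong (λ m → count P? (map (hd d) (iterate rot (rotate k xs) m))) (↭-length (rotate-↭ k xs)) ⟨
    count P? (map (hd d) (rotations (rotate k xs)))               ≡⟨ cong (count P?) (heads-rotations d (rotate k xs)) ⟩
    count P? (rotate k xs)                                        ≡⟨ count-↭ P? (rotate-↭ k xs) ⟩
    count P? xs                                                   ∎
    where open ≡-Reasoning

-- Paths, cycles and Hamiltonian paths in a graph given by its edge list.
module _ {n : ℕ} where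

  private variable
    G G' : Edges n
    e : Fin n × Fin n
    u v p q p' q' : Fin n

  _⊆ᴱ_ : Edges n → Edges n → Set
  G ⊆ᴱ G' = ∀ {u v} → Adj G u v → Adj G' u v

  ⊆ᴱ-∷ : G ⊆ᴱ (e ∷ G)
  ⊆ᴱ-∷ (inj₁ uv∈G) = inj₁ (there uv∈G)
  ⊆ᴱ-∷ (inj₂ vu∈G) = inj₂ (there vu∈G)

  adj-sym : Adj G u v → Adj G v u
  adj-sym (inj₁ uv∈G) = inj₂ uv∈G
  adj-sym (inj₂ vu∈G) = inj₁ vu∈G

  adj-∷ : Adj (e ∷ G) p q → Adj (e ∷ []) p q ⊎ Adj G p q
  adj-∷ (inj₁ (here pq≡e))  = inj₁ (inj₁ (here pq≡e))
  adj-∷ (inj₁ (there pq∈G)) = inj₂ (inj₁ pq∈G)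
  adj-∷ (inj₂ (here qp≡e))  = inj₁ (inj₂ (here qp≡e))
  adj-∷ (inj₂ (there qp∈G)) = inj₂ (inj₂ qp∈G)

  ¬adj-∷ : ¬ Adj (e ∷ []) p q → ¬ Adj G p q → ¬ Adj (e ∷ G) p q
  ¬adj-∷ ¬new ¬old pq with adj-∷ pq
  ... | inj₁ new = ¬new new
  ... | inj₂ old = ¬old old

  edge-ends : Adj ((u , v) ∷ []) p q → Adj ((u , v) ∷ []) p' q' →
              (p ≡ p' × q ≡ q') ⊎ (p ≡ q' × q ≡ p')
  edge-ends (inj₁ (here refl)) (inj₁ (here refl)) = inj₁ (refl , refl)
  edge-ends (inj₁ (here refl)) (inj₂ (here refl)) = inj₂ (refl , refl)
  edge-ends (inj₂ (here refl)) (inj₁ (here refl)) = inj₂ (refl , refl)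
  edge-ends (inj₂ (here refl)) (inj₂ (here refl)) = inj₁ (refl , refl)

  path-mono : G ⊆ᴱ G' → ∀ xs → Path G xs → Path G' xs
  path-mono G⊆G' []           _            = tt
  path-mono G⊆G' (x ∷ [])     _            = tt
  path-mono G⊆G' (x ∷ y ∷ xs) (xy , path) = G⊆G' xy , path-mono G⊆G' (y ∷ xs) path

  path-∷ʳ : ∀ xs a b → Path G (xs ∷ʳ a) → Adj G a b → Path G (xs ∷ʳ a ∷ʳ b)
  path-∷ʳ []           a b _            ab = ab , tt
  path-∷ʳ (x ∷ [])     a b (xa , _)     ab = xa , ab , tt
  path-∷ʳ (x ∷ y ∷ xs) a b (xy , path) ab = xy , path-∷ʳ (y ∷ xs) a b path ab

  path-∷ʳ⁻ : ∀ xs a → Path G (xs ∷ʳ a) → Path G xs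
  path-∷ʳ⁻ []           a _            = tt
  path-∷ʳ⁻ (x ∷ [])     a _            = tt
  path-∷ʳ⁻ (x ∷ y ∷ xs) a (xy , path) = xy , path-∷ʳ⁻ (y ∷ xs) a path

  cycle-unique : ∀ C → IsCycle G C → Unique C
  cycle-unique (c ∷ cs) (_ , uniq , _) = uniq

  cycle-mono : G ⊆ᴱ G' → ∀ C → IsCycle G C → IsCycle G' C
  cycle-mono G⊆G' (c ∷ cs) (len , uniq , path) = len , uniq , path-mono G⊆G' ((c ∷ cs) ∷ʳ c) path

  cycle-rot : ∀ C → IsCycle G C → IsCycle G (rot C)
  cycle-rot (c ∷ [])      (s≤s () , _)
  cycle-rot (c ∷ d ∷ cs) (len , uniq , cd , path) =
    ≤-trans len (≤-reflexive (sym (↭-length (rot-↭ (c ∷ d ∷ cs))))) ,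
    rot-unique uniq ,
    path-∷ʳ (d ∷ cs) c d path cd

  rotation-cycle : ∀ {C D} → IsCycle G C → D ∈ rotations C → IsCycle G D × D ↭ C
  rotation-cycle C-cycle = rotations-preserve (λ D → IsCycle _ D × D ↭ _)
    (λ { {D} (D-cycle , D↭C) → cycle-rot D D-cycle , ↭-trans (rot-↭ D) D↭C }) (C-cycle , ↭-refl)

  cycle-from : ∀ {C x} → IsCycle G C → x ∈ C → ∃[ rest ] IsCycle G (x ∷ rest) × (x ∷ rest) ↭ C
  cycle-from {C = C} {x} C-cycle x∈C
    with ∈-map⁻ (hd x) (subst (x ∈_) (sym (heads-rotations x C)) x∈C)
  ... | D , D∈ , x≡hd with D | rotation-cycle C-cycle D∈
  ...   | []       | () , _
  ...   | d ∷ rest | rotated rewrite x≡hd = rest , rotated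

  HamPath : Edges n → List (Fin n) → Fin n → Fin n → Set
  HamPath G C u v = ∃[ M ] Path G (u ∷ M ∷ʳ v) × Unique (u ∷ M ∷ʳ v) × (u ∷ M ∷ʳ v) ↭ C

  cycle⇒hamPath : ∀ {C x y} M → IsCycle G (x ∷ y ∷ M) → (x ∷ y ∷ M) ↭ C → HamPath G C y x
  cycle⇒hamPath {x = x} {y} M (_ , uniq , _ , path) D↭C =
    M , path , rot-unique uniq , ↭-trans (rot-↭ (x ∷ y ∷ M)) D↭C

  hamPath-mono : ∀ {C} → G ⊆ᴱ G' → HamPath G C u v → HamPath G' C u v
  hamPath-mono G⊆G' (M , path , uniq , L↭C) = M , path-mono G⊆G' _ path , uniq , L↭C

  hamPath-ends : ∀ {C} → HamPath G C u v → u ∈ C × v ∈ C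
  hamPath-ends {u = u} {v} (M , _ , _ , L↭C) = ∈-resp-↭ L↭C (here refl) , ∈-resp-↭ L↭C (there (∈-++⁺ʳ M (here refl)))

  close-cycle : ∀ {C} (s : State n) {y} → HamPath (walker s) C u v → y ∉ C →
                Adj (walker s) y u → Adj (walker s) v y → Goal C s
  close-cycle {u = u} {v} s {y} (M , path , uniq , L↭C) y∉C yu vy =
    y ∷ u ∷ M ∷ʳ v ,
    (s≤s (s≤s (subst (1 ≤_) (sym (length-++ M)) (m≤n+m 1 (length M)))) ,
     ¬Any⇒All¬ _ (y∉C ∘ ∈-resp-↭ L↭C) ∷ uniq ,
     yu , path-∷ʳ (u ∷ M) v y path vy) ,
    (λ z z∈C → there (∈-resp-↭ (↭-sym L↭C) z∈C)) ,
    (y , here refl , y∉C)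

-- Breaker degrees d_B(p, A) and the handshake bound.
module _ {n : ℕ} where

  private variable
    e : Fin n × Fin n
    p q : Fin n

  End : Fin n × Fin n → Fin n → Set
  End (u , w) v = v ≡ u ⊎ v ≡ w

  End? : ∀ e → Decidable (End e)
  End? (u , w) = (_≟ᶠ u) ∪? (_≟ᶠ w)

  adj-end : Adj (e ∷ []) p q → End e p
  adj-end (inj₁ (here refl)) = inj₁ refl
  adj-end (inj₂ (here refl)) = inj₂ refl

  deg-edge : ∀ {A} → Unique A → deg (e ∷ []) p A ≤ 1
  deg-edge {e = e} {p} = count-≤1 (Adj? (e ∷ []) p) one-neighbour
    where
    one-neighbour : ∀ {c c'} → Adj (e ∷ []) p c → Adj (e ∷ []) p c' → c ≡ c'
    one-neighbour pc pc' with edge-ends pc pc'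
    ... | inj₁ (_ , c≡c')       = c≡c'
    ... | inj₂ (p≡c' , c≡p)     = trans c≡p p≡c'

  deg-edge-¬End : ∀ A → ¬ End e p → deg (e ∷ []) p A ≡ 0
  deg-edge-¬End {e = e} {p} A ¬end =
    cong length (filter-none (Adj? (e ∷ []) p) (All.universal (λ _ → ¬end ∘ adj-end) A))

  deg-[] : ∀ A → deg [] p A ≡ 0
  deg-[] {p} A = cong length (filter-none (Adj? [] p) (All.universal (λ _ → λ { (inj₁ ()) ; (inj₂ ()) }) A))

  deg-∷ : ∀ B A → deg (e ∷ B) p A ≤ deg (e ∷ []) p A + deg B p A
  deg-∷ {e} {p} B A = ≤-trans (count-mono (Adj? (e ∷ B) p) (Adj? (e ∷ []) p ∪? Adj? B p) adj-∷ A)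
                               (count-∪ (Adj? (e ∷ []) p) (Adj? B p) A)

  deg-∷-≤ : ∀ B {A} → Unique A → deg (e ∷ B) p A ≤ suc (deg B p A)
  deg-∷-≤ B {A} uniq = ≤-trans (deg-∷ B A) (+-monoˡ-≤ (deg B _ A) (deg-edge uniq))

  deg-∷-mono : ∀ B A → deg B p A ≤ deg (e ∷ B) p A
  deg-∷-mono {p} {e} B A = count-mono (Adj? B p) (Adj? (e ∷ B) p) ⊆ᴱ-∷ A

  degSum : Edges n → List (Fin n) → List (Fin n) → ℕ
  degSum B V A = sum (map (λ v → deg B v A) V)

  degSum-edge : ∀ e V {A} → Unique A → degSum (e ∷ []) V A ≤ count (End? e) V
  degSum-edge e [] uniq = z≤n
  degSum-edge (u , w) (v ∷ V) {A} uniq with End? (u , w) v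
  ... | yes end rewrite filter-accept (End? (u , w)) {xs = V} end =
    +-mono-≤ (deg-edge uniq) (degSum-edge (u , w) V uniq)
  ... | no ¬end rewrite filter-reject (End? (u , w)) {xs = V} ¬end = subst (_≤ count (End? (u , w)) V)
                        (cong (_+ degSum ((u , w) ∷ []) V A) (sym (deg-edge-¬End A ¬end)))
                        (degSum-edge (u , w) V uniq)

  count-End : ∀ e {V} → Unique V → count (End? e) V ≤ 2
  count-End (u , w) {V} uniq = ≤-trans (count-∪ (_≟ᶠ u) (_≟ᶠ w) V)
    (+-mono-≤ (count-≤1 (_≟ᶠ u) (λ p≡u q≡u → trans p≡u (sym q≡u)) uniq)
              (count-≤1 (_≟ᶠ w) (λ p≡w q≡w → trans p≡w (sym q≡w)) uniq))

  degSum-∷ : ∀ B V A → degSum (e ∷ B) V A ≤ degSum (e ∷ []) V A + degSum B V A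
  degSum-∷ B []      A = z≤n
  degSum-∷ {e} B (v ∷ V) A = ≤-trans (+-mono-≤ (deg-∷ B A) (degSum-∷ B V A))
    (≤-reflexive (interchange (deg (e ∷ []) v A) (deg B v A) (degSum (e ∷ []) V A) (degSum B V A)))

  handshake : ∀ B {V A} → Unique V → Unique A → degSum B V A ≤ 2 * length B
  handshake [] {V} {A} _ _ = ≤-reflexive (degSum-[] V)
    where
    degSum-[] : ∀ V → degSum [] V A ≡ 0
    degSum-[] []      = refl
    degSum-[] (v ∷ V) = cong₂ _+_ (deg-[] A) (degSum-[] V)
  handshake (e ∷ B) {V} {A} uniqV uniqA = begin
    degSum (e ∷ B) V A                  ≤⟨ degSum-∷ B V A ⟩
    degSum (e ∷ []) V A + degSum B V A  ≤⟨ +-mono-≤ (≤-trans (degSum-edge e V uniqA) (count-End e uniqV)) (handshake B uniqV uniqA) ⟩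
    2 + 2 * length B                    ≡⟨ *-distribˡ-+ 2 1 (length B) ⟨
    2 * length (e ∷ B)                  ∎
    where open ≤-Reasoning

  degSum-heavy : ∀ B V A → All (λ v → n ≤ 4 * deg B v A) V → length V * n ≤ 4 * degSum B V A
  degSum-heavy B []      A []             = z≤n
  degSum-heavy B (v ∷ V) A (heavy ∷ all) =
    ≤-trans (+-mono-≤ heavy (degSum-heavy B V A all)) (≤-reflexive (sym (*-distribˡ-+ 4 (deg B v A) (degSum B V A))))

module _ {n : ℕ} where

  private variable
    G : Edges n
    u v p q : Fin n

  adj-edge-transfer : Adj ((u , v) ∷ []) p q → Adj G p q → Adj G u v
  adj-edge-transfer (inj₁ (here refl)) pq = pq
  adj-edge-transfer (inj₂ (here refl)) pq = adj-sym pq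

  reachable-disjoint : ∀ {s} → Reachable s → Adj (walker s) u v → ¬ Adj (breaker s) u v
  reachable-disjoint (start _) (inj₁ ()) _
  reachable-disjoint (start _) (inj₂ ()) _
  reachable-disjoint (round w a b play (_ , ¬breaker) (_ , ¬walker , _)) uv∈W uv∈B with adj-∷ uv∈B
  ... | inj₁ new-edge = ¬walker (adj-edge-transfer new-edge uv∈W)
  ... | inj₂ old-edge with adj-∷ uv∈W
  ...   | inj₁ new-walk = ¬breaker (adj-edge-transfer new-walk old-edge)
  ...   | inj₂ old-walk = reachable-disjoint play old-walk old-edge

  goal⇒forces : ∀ k {C} {s : State n} → Goal C s → Forces k C s
  goal⇒forces zero    goal = goal
  goal⇒forces (suc k) goal = inj₁ goal

  forces-≤ : ∀ {k k' C} {s : State n} → k ≤ k' → Forces k C s → Forces k' C s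
  forces-≤ {k' = k'} z≤n goal = goal⇒forces k' goal
  forces-≤ (s≤s k≤k') (inj₁ goal)                 = inj₁ goal
  forces-≤ (s≤s k≤k') (inj₂ (w , legal , inj₁ goal)) = inj₂ (w , legal , inj₁ goal)
  forces-≤ (s≤s k≤k') (inj₂ (w , legal , inj₂ next)) =
    inj₂ (w , legal , inj₂ (λ a b breaker-legal → forces-≤ k≤k' (next a b breaker-legal)))

module _ {n : ℕ} where

  open DecMembership (_≟ᶠ_ {n}) using (_∈?_)

  count-∈-allFin : ∀ C → count (_∈? C) (allFin n) ≤ length C
  count-∈-allFin []      = ≤-reflexive (cong length (filter-none (_∈? []) (All.universal (λ _ ()) (allFin n))))
  count-∈-allFin (c ∷ C) = begin
    count (_∈? (c ∷ C)) (allFin n)                       ≤⟨ count-mono (_∈? (c ∷ C)) ((_≟ᶠ c) ∪? (_∈? C)) split (allFin n) ⟩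
    count ((_≟ᶠ c) ∪? (_∈? C)) (allFin n)                ≤⟨ count-∪ (_≟ᶠ c) (_∈? C) (allFin n) ⟩
    count (_≟ᶠ c) (allFin n) + count (_∈? C) (allFin n)  ≤⟨ +-mono-≤ (count-≤1 (_≟ᶠ c) (λ x≡c y≡c → trans x≡c (sym y≡c)) (UP.allFin⁺ n))
                                                                       (count-∈-allFin C) ⟩
    suc (length C)                                       ∎
    where
    open ≤-Reasoning
    split : ∀ {x} → x ∈ c ∷ C → x ≡ c ⊎ x ∈ C
    split (here x≡c)  = inj₁ x≡c
    split (there x∈C) = inj₂ x∈C

  outside : List (Fin n) → List (Fin n)
  outside C = filter (∁? (_∈? C)) (allFin n)

  outside-unique : ∀ C → Unique (outside C)
  outside-unique C = UP.filter⁺ (∁? (_∈? C)) (UP.allFin⁺ n)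

  outside-∉ : ∀ C → All (_∉ C) (outside C)
  outside-∉ C = All.tabulate (λ y∈ → proj₂ (∈-filter⁻ (∁? (_∈? C)) {xs = allFin n} y∈))

  length-outside : ∀ C → 3 ≤ n → length C ≤ n ∸ 3 → 3 ≤ length (outside C)
  length-outside C 3≤n |C|≤n∸3 = begin
    3                                  ≡⟨ m∸[m∸n]≡n 3≤n ⟨
    n ∸ (n ∸ 3)                        ≤⟨ ∸-monoʳ-≤ n (≤-trans (count-∈-allFin C) |C|≤n∸3) ⟩
    n ∸ count (_∈? C) (allFin n)       ≡⟨ cong (_∸ count (_∈? C) (allFin n)) total ⟨
    (count (_∈? C) (allFin n) + length (outside C)) ∸ count (_∈? C) (allFin n) ≡⟨ m+n∸m≡n (count (_∈? C) (allFin n)) _ ⟩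
    length (outside C)                 ∎
    where
    open ≤-Reasoning
    total : count (_∈? C) (allFin n) + length (outside C) ≡ n
    total = trans (count+count-∁ (_∈? C) (allFin n)) (length-tabulate (λ (i : Fin n) → i))

  -- Among three distinct vertices outside C at most one is heavy, so two are light:
  -- d_B(y, V(C)) < n/10.
  two-light-outside : ∀ B C → AtMostOneHeavy B C → 3 ≤ length (outside C) →
                      ∃[ y₁ ] ∃[ y₂ ] y₁ ∉ C × y₂ ∉ C × y₁ ≢ y₂ × 10 * deg B y₁ C < n × 10 * deg B y₂ C < n
  two-light-outside B C one-heavy 3≤ = pick (outside C) 3≤ (outside-unique C) (outside-∉ C)
    where
    pick : ∀ O → 3 ≤ length O → Unique O → All (_∉ C) O →
           ∃[ y₁ ] ∃[ y₂ ] y₁ ∉ C × y₂ ∉ C × y₁ ≢ y₂ × 10 * deg B y₁ C < n × 10 * deg B y₂ C < n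
    pick []              ()                    _ _
    pick (_ ∷ [])        (s≤s ())              _ _
    pick (_ ∷ _ ∷ [])    (s≤s (s≤s ()))        _ _
    pick (a ∷ b ∷ c ∷ _) _ ((a≢b ∷ a≢c ∷ _) ∷ (b≢c ∷ _) ∷ _) (a∉ ∷ b∉ ∷ c∉ ∷ _)
      with n ≤? 10 * deg B a C | n ≤? 10 * deg B b C | n ≤? 10 * deg B c C
    ... | no a-light  | no b-light  | _           = a , b , a∉ , b∉ , a≢b , ≰⇒> a-light , ≰⇒> b-light
    ... | no a-light  | yes _       | no c-light  = a , c , a∉ , c∉ , a≢c , ≰⇒> a-light , ≰⇒> c-light
    ... | yes _       | no b-light  | no c-light  = b , c , b∉ , c∉ , b≢c , ≰⇒> b-light , ≰⇒> c-light
    ... | yes a-heavy | yes b-heavy | _           = ⊥-elim (a≢b (one-heavy a b a∉ b∉ a-heavy b-heavy))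
    ... | yes a-heavy | no _        | yes c-heavy = ⊥-elim (a≢c (one-heavy a c a∉ c∉ a-heavy c-heavy))
    ... | no _        | yes b-heavy | yes c-heavy = ⊥-elim (b≢c (one-heavy b c b∉ c∉ b-heavy c-heavy))

-- Seventeen vertices with d_B ≥ n/4 give a degree sum ≥ 17n/4, beyond the handshake
-- bound 2(2n + 17) once n > 136.
seventeen-heavy-impossible : ∀ {n S b} → 5000 ≤ n → 17 * n ≤ 4 * S → S ≤ 2 * b → b ≤ 2 * n + 17 → ⊥
seventeen-heavy-impossible {n} {S} {b} n≥5000 heavy handshake breaker-edges =
  <⇒≱ (≤-trans (s≤s (m≤m+n 136 4863)) n≥5000) (+-cancelʳ-≤ (16 * n) n 136 (begin
    n + 16 * n               ≤⟨ heavy ⟩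
    4 * S                    ≤⟨ *-monoʳ-≤ 4 (≤-trans handshake (*-monoʳ-≤ 2 breaker-edges)) ⟩
    4 * (2 * (2 * n + 17))   ≡⟨ expand n ⟩
    136 + 16 * n             ∎))
  where
  open ≤-Reasoning
  expand : ∀ n → 4 * (2 * (2 * n + 17)) ≡ 136 + 16 * n
  expand = solve-∀

-- The counting bound of the detour search: with d_B(z) < n/4 and both outside
-- degrees below n/10 + 17, the obstructions 1 + d_B(z) + 3(d_B(y₁) + d_B(y₂))
-- number fewer than v(C) ≥ n - 125.
few-obstructions : ∀ {n c dz d₁ d₂ e₁ e₂} → 5000 ≤ n → n ≤ 125 + c →
                   4 * dz ≤ n → 10 * d₁ ≤ n → 10 * d₂ ≤ n → e₁ ≤ 17 + d₁ → e₂ ≤ 17 + d₂ →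
                   suc (suc (dz + 3 * (e₁ + e₂))) ≤ c
few-obstructions {n} {c} {dz} {d₁} {d₂} {e₁} {e₂} n≥5000 n≤125+c dz≤ d₁≤ d₂≤ e₁≤ e₂≤ =
  *-cancelˡ-≤ 20 (+-cancelˡ-≤ 2500 _ _ (begin
    2500 + 20 * suc (suc (dz + 3 * (e₁ + e₂)))           ≡⟨ regroup dz e₁ e₂ ⟩
    2540 + (5 * (4 * dz) + (6 * (10 * e₁) + 6 * (10 * e₂))) ≤⟨ +-monoʳ-≤ 2540 (+-mono-≤ (*-monoʳ-≤ 5 dz≤)
                                                                (+-mono-≤ (*-monoʳ-≤ 6 (outside-degree e₁≤ d₁≤))
                                                                          (*-monoʳ-≤ 6 (outside-degree e₂≤ d₂≤)))) ⟩
    2540 + (5 * n + (6 * (170 + n) + 6 * (170 + n)))       ≡⟨ collect n ⟩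
    4580 + 17 * n                                          ≤⟨ +-monoˡ-≤ (17 * n) (≤-trans (m≤m+n 4580 10420) (*-monoʳ-≤ 3 n≥5000)) ⟩
    3 * n + 17 * n                                         ≡⟨ *-distribʳ-+ n 3 17 ⟨
    20 * n                                                 ≤⟨ *-monoʳ-≤ 20 n≤125+c ⟩
    20 * (125 + c)                                         ≡⟨ *-distribˡ-+ 20 125 c ⟩
    2500 + 20 * c                                          ∎))
  where
  open ≤-Reasoning
  regroup : ∀ dz e₁ e₂ → 2500 + 20 * suc (suc (dz + 3 * (e₁ + e₂))) ≡ 2540 + (5 * (4 * dz) + (6 * (10 * e₁) + 6 * (10 * e₂)))
  regroup = solve-∀
  collect : ∀ n → 2540 + (5 * n + (6 * (170 + n) + 6 * (170 + n))) ≡ 4580 + 17 * n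
  collect = solve-∀
  outside-degree : ∀ {e d} → e ≤ 17 + d → 10 * d ≤ n → 10 * e ≤ 170 + n
  outside-degree {e} {d} e≤ d≤ = ≤-trans (*-monoʳ-≤ 10 e≤) (≤-trans (≤-reflexive (*-distribˡ-+ 10 17 d)) (+-monoʳ-≤ 170 d≤))

module Strategy {n : ℕ} (C : List (Fin n)) (C-unique : Unique C)
                (y₁ y₂ : Fin n) (y₁∉C : y₁ ∉ C) (y₂∉C : y₂ ∉ C) (y₁≢y₂ : y₁ ≢ y₂) where

  private variable
    u v y c c' : Fin n

  outside≢inside : y ∉ C → c ∈ C → y ≢ c
  outside≢inside y∉C c∈C refl = y∉C c∈C

  Untouched : Edges n → Fin n → List (Fin n) → Set
  Untouched B y T = All (λ c → ¬ Adj B y c) T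

  untouched-∷ : ∀ {e B T} → Untouched (e ∷ []) y T → Untouched B y T → Untouched (e ∷ B) y T
  untouched-∷ new old = All.zipWith (λ (¬new , ¬old) → ¬adj-∷ ¬new ¬old) (new , old)

  one-edge-one-outside : c ∈ C → c' ∈ C → Adj ((u , v) ∷ []) y₁ c → ¬ Adj ((u , v) ∷ []) y₂ c'
  one-edge-one-outside c∈C c'∈C y₁c y₂c' with edge-ends y₁c y₂c'
  ... | inj₁ (y₁≡y₂ , _) = y₁≢y₂ y₁≡y₂
  ... | inj₂ (y₁≡c' , _) = outside≢inside y₁∉C c'∈C y₁≡c'

  one-edge-one-inside : y ∉ C → c' ∈ C → c ≢ c' → Adj ((u , v) ∷ []) y c → ¬ Adj ((u , v) ∷ []) y c'
  one-edge-one-inside y∉C c'∈C c≢c' yc yc' with edge-ends yc yc'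
  ... | inj₁ (_ , c≡c') = c≢c' c≡c'
  ... | inj₂ (y≡c' , _) = outside≢inside y∉C c'∈C y≡c'

  keep-untouched : ∀ {B T} → All (_∈ C) T → Untouched B y₁ T → Untouched B y₂ T →
                   ∀ u v → ∃[ y ] y ∉ C × Untouched ((u , v) ∷ B) y T
  keep-untouched {T = T} T⊆C free₁ free₂ u v with any? (Adj? ((u , v) ∷ []) y₁) T
  ... | no ¬touched₁ = y₁ , y₁∉C , untouched-∷ (¬Any⇒All¬ T ¬touched₁) free₁
  ... | yes touched₁ with find touched₁
  ...   | c , c∈T , y₁c = y₂ , y₂∉C ,
          untouched-∷ (All.map (λ c'∈C → one-edge-one-outside (All.lookup T⊆C c∈T) c'∈C y₁c) T⊆C) free₂

  -- Breaker's last edge uv blocks at most one of yb₁, yb₂, and walking along the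
  -- other one closes a cycle on V(C) ∪ {y}.
  last-round : ∀ W B {a b₁ b₂} u v → HamPath W C a b₁ → HamPath W C b₂ a → b₁ ≢ b₂ → y ∉ C →
               ¬ Adj B y b₁ → ¬ Adj B y b₂ → Forces 1 C (st ((a , y) ∷ W) ((u , v) ∷ B) y)
  last-round {y} W B {a} {b₁} {b₂} u v path₁ path₂ b₁≢b₂ y∉C ¬yb₁ ¬yb₂
    with Adj? ((u , v) ∷ []) y b₂
  ... | no ¬new-yb₂ =
    inj₂ (b₂ , (outside≢inside y∉C b₂∈C , ¬adj-∷ ¬new-yb₂ ¬yb₂) ,
          inj₁ (close-cycle (st ((y , b₂) ∷ (a , y) ∷ W) ((u , v) ∷ B) b₂) (hamPath-mono (⊆ᴱ-∷ ∘ ⊆ᴱ-∷) path₂) y∉C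
                            (inj₁ (here refl)) (inj₁ (there (here refl)))))
    where b₂∈C = proj₁ (hamPath-ends path₂)
  ... | yes new-yb₂ =
    inj₂ (b₁ , (outside≢inside y∉C b₁∈C , ¬adj-∷ (λ new-yb₁ → one-edge-one-inside y∉C b₂∈C b₁≢b₂ new-yb₁ new-yb₂) ¬yb₁) ,
          inj₁ (close-cycle (st ((y , b₁) ∷ (a , y) ∷ W) ((u , v) ∷ B) b₁) (hamPath-mono (⊆ᴱ-∷ ∘ ⊆ᴱ-∷) path₁) y∉C
                            (inj₂ (there (here refl))) (inj₂ (here refl))))
    where
    b₁∈C = proj₂ (hamPath-ends path₁)
    b₂∈C = proj₁ (hamPath-ends path₂)

  middle-round : ∀ W B {a b₁ b₂} → HamPath W C a b₁ → HamPath W C b₂ a → b₁ ≢ b₂ → y ∉ C →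
                 Untouched B y (b₁ ∷ a ∷ b₂ ∷ []) → Forces 2 C (st W B a)
  middle-round {y} W B path₁ path₂ b₁≢b₂ y∉C (¬yb₁ ∷ ¬ya ∷ ¬yb₂ ∷ []) =
    inj₂ (y , (outside≢inside y∉C (proj₁ (hamPath-ends path₁)) ∘ sym , ¬ya ∘ adj-sym) ,
          inj₂ (λ u v _ → last-round W B u v path₁ path₂ b₁≢b₂ y∉C ¬yb₁ ¬yb₂))

  -- A detour site for Walker at pos s: a cycle vertex a she may walk to, whose two cycle
  -- neighbours b₁, b₂ (so that C minus ab₁, resp. minus ab₂, is a Hamiltonian path) and a
  -- itself are joined by Breaker to neither y₁ nor y₂.
  record DetourSite (s : State n) : Set where
    field
      a b₁ b₂ : Fin n
      path₁   : HamPath (walker s) C a b₁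
      path₂   : HamPath (walker s) C b₂ a
      b₁≢b₂   : b₁ ≢ b₂
      to-a    : WalkerLegal s a
      free₁   : Untouched (breaker s) y₁ (b₁ ∷ a ∷ b₂ ∷ [])
      free₂   : Untouched (breaker s) y₂ (b₁ ∷ a ∷ b₂ ∷ [])

  -- From a detour site Walker extends C within three rounds: to a, then to y₁ or y₂
  -- (whichever Breaker's reply left untouched), then back to b₁ or b₂.
  detour : ∀ {s} → DetourSite s → Forces 3 C s
  detour {st W B z} site = inj₂ (a , to-a , inj₂ λ u v _ →
    let (y , y∉C , free) = keep-untouched (b₁∈C ∷ a∈C ∷ b₂∈C ∷ []) free₁ free₂ u v
    in  middle-round ((z , a) ∷ W) ((u , v) ∷ B) (hamPath-mono ⊆ᴱ-∷ path₁) (hamPath-mono ⊆ᴱ-∷ path₂) b₁≢b₂ y∉C free)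
    where
    open DetourSite site
    a∈C  = proj₁ (hamPath-ends path₁)
    b₁∈C = proj₂ (hamPath-ends path₁)
    b₂∈C = proj₁ (hamPath-ends path₂)

  Blocked : Edges n → Fin n → Set
  Blocked B c = Adj B y₁ c ⊎ Adj B y₂ c

  Blocked? : ∀ B → Decidable (Blocked B)
  Blocked? B = Adj? B y₁ ∪? Adj? B y₂

  count-blocked : ∀ B → count (Blocked? B) C ≤ deg B y₁ C + deg B y₂ C
  count-blocked B = count-∪ (Adj? B y₁) (Adj? B y₂) C

  Unreachable : State n → Fin n → Set
  Unreachable s c = pos s ≡ c ⊎ Adj (breaker s) (pos s) c

  Unreachable? : ∀ s → Decidable (Unreachable s)
  Unreachable? s = (pos s ≟ᶠ_) ∪? Adj? (breaker s) (pos s)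

  count-unreachable : ∀ s → count (Unreachable? s) C ≤ suc (deg (breaker s) (pos s) C)
  count-unreachable s = ≤-trans (count-∪ (pos s ≟ᶠ_) (Adj? (breaker s) (pos s)) C)
    (+-monoˡ-≤ _ (count-≤1 (pos s ≟ᶠ_) (λ z≡c z≡c' → trans (sym z≡c) z≡c') C-unique))

  entry : ℕ → List (Fin n) → Fin n
  entry k D = hd y₁ (rotate k D)

  Obstructed : State n → List (Fin n) → Set
  Obstructed s D = Unreachable s (entry 1 D) ⊎ Blocked (breaker s) (entry 0 D) ⊎
                   Blocked (breaker s) (entry 1 D) ⊎ Blocked (breaker s) (entry 2 D)

  Obstructed? : ∀ s → Decidable (Obstructed s)
  Obstructed? s = (Unreachable? s ∘ entry 1) ∪? (Blocked? (breaker s) ∘ entry 0) ∪?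
                  (Blocked? (breaker s) ∘ entry 1) ∪? (Blocked? (breaker s) ∘ entry 2)

  -- Each condition fails for as many rotations as there are vertices of C with the
  -- corresponding property, so at most 1 + d_B(z) + 3 (d_B(y₁) + d_B(y₂)) rotations are obstructed.
  count-obstructed : ∀ s → count (Obstructed? s) (rotations C) ≤
                     suc (deg (breaker s) (pos s) C + 3 * (deg (breaker s) y₁ C + deg (breaker s) y₂ C))
  count-obstructed s = begin
    count (Obstructed? s) (rotations C)
      ≤⟨ count-∪ (Unreachable? s ∘ entry 1) _ (rotations C) ⟩
    count (Unreachable? s ∘ entry 1) (rotations C) + count ((Blocked? B ∘ entry 0) ∪? (Blocked? B ∘ entry 1) ∪? (Blocked? B ∘ entry 2)) (rotations C)
      ≤⟨ +-monoʳ-≤ _ (≤-trans (count-∪ (Blocked? B ∘ entry 0) _ (rotations C))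
                              (+-monoʳ-≤ _ (count-∪ (Blocked? B ∘ entry 1) (Blocked? B ∘ entry 2) (rotations C)))) ⟩
    count (Unreachable? s ∘ entry 1) (rotations C) + (count (Blocked? B ∘ entry 0) (rotations C) +
      (count (Blocked? B ∘ entry 1) (rotations C) + count (Blocked? B ∘ entry 2) (rotations C)))
      ≡⟨ cong₂ _+_ (count-rotations (Unreachable? s) y₁ 1 C)
                   (cong₂ _+_ (count-rotations (Blocked? B) y₁ 0 C)
                              (cong₂ _+_ (count-rotations (Blocked? B) y₁ 1 C) (count-rotations (Blocked? B) y₁ 2 C))) ⟩
    count (Unreachable? s) C + (count (Blocked? B) C + (count (Blocked? B) C + count (Blocked? B) C))
      ≤⟨ +-mono-≤ (count-unreachable s) (+-mono-≤ (count-blocked B) (+-mono-≤ (count-blocked B) (count-blocked B))) ⟩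
    suc (deg B (pos s) C) + (X + (X + X))
      ≡⟨ cong (λ t → suc (deg B (pos s) C + (X + (X + t)))) (+-identityʳ X) ⟨
    suc (deg B (pos s) C + 3 * X) ∎
    where
    open ≤-Reasoning
    B = breaker s
    X = deg B y₁ C + deg B y₂ C

  find-detour : ∀ s → IsCycle (walker s) C →
                suc (suc (deg (breaker s) (pos s) C + 3 * (deg (breaker s) y₁ C + deg (breaker s) y₂ C))) ≤ length C →
                DetourSite s
  find-detour s C-cycle few
    with count<length⇒∃¬ (Obstructed? s) (rotations C)
           (≤-trans (s≤s (count-obstructed s)) (≤-trans few (≤-reflexive (sym (length-iterate rot C (length C))))))
  ... | D , D∈ , unobstructed with D | rotation-cycle C-cycle D∈
  ...   | d₀ ∷ d₁ ∷ d₂ ∷ r | D-cycle@(_ , (_ ∷ d₀≢d₂ ∷ _) ∷ _ , _) , D↭C = record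
    { a = d₁ ; b₁ = d₀ ; b₂ = d₂
    ; path₁ = cycle⇒hamPath (d₂ ∷ r) D-cycle D↭C
    ; path₂ = cycle⇒hamPath (r ∷ʳ d₀) (cycle-rot (d₀ ∷ d₁ ∷ d₂ ∷ r) D-cycle) (↭-trans (rot-↭ (d₀ ∷ d₁ ∷ d₂ ∷ r)) D↭C)
    ; b₁≢b₂ = d₀≢d₂
    ; to-a  = (unobstructed ∘ inj₁ ∘ inj₁) , (unobstructed ∘ inj₁ ∘ inj₂)
    ; free₁ = (unobstructed ∘ inj₂ ∘ inj₁ ∘ inj₁) ∷ (unobstructed ∘ inj₂ ∘ inj₂ ∘ inj₁ ∘ inj₁) ∷ (unobstructed ∘ inj₂ ∘ inj₂ ∘ inj₂ ∘ inj₁) ∷ []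
    ; free₂ = (unobstructed ∘ inj₂ ∘ inj₁ ∘ inj₂) ∷ (unobstructed ∘ inj₂ ∘ inj₂ ∘ inj₁ ∘ inj₂) ∷ (unobstructed ∘ inj₂ ∘ inj₂ ∘ inj₂ ∘ inj₂) ∷ []
    }
  ...   | [] | () , _
  ...   | _ ∷ [] | (s≤s () , _) , _
  ...   | _ ∷ _ ∷ [] | (s≤s (s≤s ()) , _) , _

  -- Phase one: while Walker stands on a vertex z of C with d_B(z, V(C)) ≥ n/4 she keeps
  -- walking along C on her own edges (so Breaker can never block her).  Seventeen such
  -- vertices would need more Breaker edges than exist, so within 17 steps she reaches a
  -- vertex of smaller degree, where a detour site exists and three more rounds suffice.
  module WalkPhase (n≥5000 : 5000 ≤ n) (n≤125+|C| : n ≤ 125 + length C)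
                   (d₁ d₂ : ℕ) (d₁-light : 10 * d₁ < n) (d₂-light : 10 * d₂ < n) where

    Heavy : Edges n → Fin n → Set
    Heavy B v = n ≤ 4 * deg B v C

    -- Walker has visited the heavy vertices V along C and still has the cycle vertices
    -- rest ahead of her; Breaker has claimed at most one edge per step, each raising the
    -- degrees of y₁, y₂ (initially d₁, d₂) by at most one.
    record WalkInvariant (s : State n) (V rest : List (Fin n)) : Set where
      field
        reachable     : Reachable s
        cycle         : IsCycle (walker s) C
        distinct      : Unique (V ++ pos s ∷ rest)
        route         : Path (walker s) (pos s ∷ rest)
        on-cycle      : All (_∈ C) (pos s ∷ rest)
        visited-heavy : All (Heavy (breaker s)) V
        breaker-edges : length (breaker s) ≤ 2 * n + length V
        degree₁       : deg (breaker s) y₁ C ≤ length V + d₁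
        degree₂       : deg (breaker s) y₂ C ≤ length V + d₂

    initial-invariant : ∀ {s rest} → Reachable s → IsCycle (walker s) C →
                        IsCycle (walker s) (pos s ∷ rest) → (pos s ∷ rest) ↭ C → length (breaker s) ≤ 2 * n →
                        deg (breaker s) y₁ C ≤ d₁ → deg (breaker s) y₂ C ≤ d₂ → WalkInvariant s [] rest
    initial-invariant {s} {rest} play C-cycle D-cycle D↭C |B|≤2n deg₁ deg₂ = record
      { reachable     = play
      ; cycle         = C-cycle
      ; distinct      = cycle-unique _ D-cycle
      ; route         = path-∷ʳ⁻ (pos s ∷ rest) (pos s) (proj₂ (proj₂ D-cycle))
      ; on-cycle      = All.tabulate (∈-resp-↭ D↭C)
      ; visited-heavy = []
      ; breaker-edges = ≤-trans |B|≤2n (≤-reflexive (sym (+-identityʳ _)))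
      ; degree₁       = deg₁
      ; degree₂       = deg₂
      }

    -- At a vertex of degree < n/4 the obstruction count is below v(C), so Walker wins in 3 rounds.
    light-finish : ∀ {s V rest} → WalkInvariant s V rest → length V ≤ 17 → ¬ Heavy (breaker s) (pos s) →
                   Forces 3 C s
    light-finish {s} inv |V|≤17 light = detour (find-detour s cycle
      (few-obstructions {dz = deg (breaker s) (pos s) C} n≥5000 n≤125+|C| (<⇒≤ (≰⇒> light)) (<⇒≤ d₁-light) (<⇒≤ d₂-light)
                        (≤-trans degree₁ (+-monoˡ-≤ d₁ |V|≤17)) (≤-trans degree₂ (+-monoˡ-≤ d₂ |V|≤17))))
      where open WalkInvariant inv

    not-seventeen-heavy : ∀ {s V rest} → WalkInvariant s V rest → length V ≡ 17 → ⊥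
    not-seventeen-heavy {s} {V} inv |V|≡17 = seventeen-heavy-impossible n≥5000
      (subst (λ k → k * n ≤ 4 * degSum (breaker s) V C) |V|≡17 (degSum-heavy (breaker s) V C visited-heavy))
      (handshake (breaker s) (unique-++ˡ V distinct) C-unique)
      (subst (λ k → length (breaker s) ≤ 2 * n + k) |V|≡17 breaker-edges)
      where open WalkInvariant inv

    next-legal : ∀ {s V d rest} → WalkInvariant s V (d ∷ rest) → WalkerLegal s d
    next-legal {V = V} inv with unique-++ʳ V (WalkInvariant.distinct inv)
    ... | (z≢d ∷ _) ∷ _ = z≢d , reachable-disjoint (WalkInvariant.reachable inv) (proj₁ (WalkInvariant.route inv))

    advance : ∀ {s V d rest u v} → WalkInvariant s V (d ∷ rest) → Heavy (breaker s) (pos s) →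
              (legal : WalkerLegal s d) → BreakerLegal (walk s d) u v →
              WalkInvariant (claim (walk s d) u v) (V ∷ʳ pos s) rest
    advance {s} {V} {d} {rest} inv heavy legal breaker-legal = record
      { reachable     = round d _ _ reachable legal breaker-legal
      ; cycle         = cycle-mono ⊆ᴱ-∷ C cycle
      ; distinct      = subst Unique (sym (++-assoc V (pos s ∷ []) (d ∷ rest))) distinct
      ; route         = path-mono ⊆ᴱ-∷ (d ∷ rest) (proj₂ route)
      ; on-cycle      = All.tail on-cycle
      ; visited-heavy = ++⁺ (All.map (λ h → ≤-trans h (*-monoʳ-≤ 4 (deg-∷-mono (breaker s) C))) visited-heavy)
                            (≤-trans heavy (*-monoʳ-≤ 4 (deg-∷-mono (breaker s) C)) ∷ [])
      ; breaker-edges = ≤-trans (s≤s breaker-edges) (≤-reflexive (sym (trans (cong (2 * n +_) (length-∷ʳ V (pos s))) (+-suc _ _))))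
      ; degree₁       = ≤-trans (deg-∷-≤ (breaker s) C-unique) (≤-trans (s≤s degree₁) (≤-reflexive (cong (_+ d₁) (sym (length-∷ʳ V (pos s))))))
      ; degree₂       = ≤-trans (deg-∷-≤ (breaker s) C-unique) (≤-trans (s≤s degree₂) (≤-reflexive (cong (_+ d₂) (sym (length-∷ʳ V (pos s))))))
      }
      where open WalkInvariant inv

    -- Phase one with r steps left of the budget of 17.
    walk-phase : ∀ r {s V rest} → WalkInvariant s V rest → length V + r ≡ 17 → r ≤ length rest → Forces (3 + r) C s
    walk-phase r {s} {V} inv |V|+r≡17 r≤|rest| with n ≤? 4 * deg (breaker s) (pos s) C
    ... | no light = forces-≤ (m≤m+n 3 r) (light-finish inv (subst (length V ≤_) |V|+r≡17 (m≤m+n (length V) r)) light)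
    walk-phase zero {V = V} inv |V|+0≡17 _ | yes heavy =
      ⊥-elim (not-seventeen-heavy inv (trans (sym (+-identityʳ (length V))) |V|+0≡17))
    walk-phase (suc r) {s} {V} {d ∷ rest} inv |V|+1+r≡17 (s≤s r≤|rest|) | yes heavy =
      inj₂ (d , next-legal inv , inj₂ λ u v breaker-legal →
        walk-phase r (advance inv heavy (next-legal inv) breaker-legal)
          (trans (cong (_+ r) (length-∷ʳ V (pos s))) (trans (sym (+-suc (length V) r)) |V|+1+r≡17)) r≤|rest|)

lemma4p1 : ∃[ n₀ ] ∀ (n : ℕ) → n₀ ≤ n → (s : State n) → Reachable s →
    (C : List (Fin n)) → IsCycle (walker s) C →
    n ∸ 125 ≤ length C → length C ≤ n ∸ 3 → pos s ∈ C →
    length (breaker s) ≤ 2 * n → AtMostOneHeavy (breaker s) C →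
    Forces 24 C s
lemma4p1 = 5000 , λ n n≥5000 s play C C-cycle |C|≥n∸125 |C|≤n∸3 x∈C |B|≤2n one-heavy →
  let
    3≤n           = ≤-trans (m≤m+n 3 4997) n≥5000
    n≤125+|C|     = ≤-trans (m≤n+m∸n n 125) (+-monoʳ-≤ 125 |C|≥n∸125)
    (y₁ , y₂ , y₁∉C , y₂∉C , y₁≢y₂ , light₁ , light₂) =
      two-light-outside (breaker s) C one-heavy (length-outside C 3≤n |C|≤n∸3)
    (rest , D-cycle , D↭C) = cycle-from C-cycle x∈C
    -- v(C) ≥ n - 125 ≥ 18 leaves room for 17 steps along C
    17≤|rest| : 17 ≤ length rest
    17≤|rest| = +-cancelˡ-≤ 126 17 (length rest) (≤-trans (m≤m+n 143 4857) (≤-trans n≥5000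
                  (≤-trans n≤125+|C| (≤-reflexive (trans (cong (125 +_) (sym (↭-length D↭C))) (+-suc 125 (length rest)))))))
    open Strategy C (cycle-unique C C-cycle) y₁ y₂ y₁∉C y₂∉C y₁≢y₂
    open WalkPhase n≥5000 n≤125+|C| (deg (breaker s) y₁ C) (deg (breaker s) y₂ C) light₁ light₂
  -- phase one starts at x with no vertex visited; it needs at most 17 + 3 = 20 rounds
  in forces-≤ (m≤m+n 20 4)
       (walk-phase 17 (initial-invariant play C-cycle D-cycle D↭C |B|≤2n ≤-refl ≤-refl) refl 17≤|rest|)
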